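{- Let $M$ be a matroid and let $\mathcal X$ be a zero-nonzero pattern such that $\mathcal X^T$ is the fundamental pattern of $M$. Then $M$ has no adjoint if and only if $\operatorname{mr}\mathcal R(\mathcal X)>\operatorname{tri}(\mathcal X)$.
   Context: The fundamental pattern of a matroid $M$ is the $\{0,*\}$-matrix with one row for each hyperplane of $M$ and one column for each element of $E(M)$, whose entry in row $H$, column $e$ is $0$ if and only if $e\in H$. For a pattern $\mathcal Y$, the zero set of a row is the set of column labels where it has entry $0$; $\mathcal R(\mathcal Y)$ is the set of matroids on the set of column labels of $\mathcal Y$ in which the zero set of every row is a flat; $\operatorname{mr}\mathcal R(\mathcal Y)$ is the smallest rank of a matroid in it. A square pattern is a triangle if its rows and columns can be permuted independently to give a lower triangular pattern with all diagonal entries $*$; $\operatorname{tri}(\mathcal Y)$ is the largest $k$ such that some $k\times k$ submatrix is a triangle. A simple matroid $M'$ is an adjoint of $M$ if $r(M')=r(M)$ and there is a map $\phi$ from the lattice of flats of $M$ to that of $M'$ which is injective, inclusion-reversing ($F_1\subseteq F_2\Rightarrow \phi(F_2)\subseteq\phi(F_1)$), and restricts to a bijection from the hyperplanes of $M$ onto the rank-$1$ flats of $M'$. -}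

module Defs where

open import Level using (0ℓ)
open import Data.Nat using (ℕ; suc; _<_; _≤_)
open import Data.Bool using (Bool; true; false; not)
open import Data.Fin using (Fin) renaming (_<_ to _<ᶠ_)
open import Data.Fin.Subset using (Subset; _∈_; _∉_; _⊆_; _∪_; ⁅_⁆; ∣_∣) renaming (⊥ to ∅; ⊤ to Full)
open import Data.Vec using (tabulate)
open import Data.Product using (Σ; ∃; ∃-syntax; _×_)
open import Relation.Nullary using (Dec; ¬_)
open import Relation.Binary.PropositionalEquality using (_≡_)
open import Function.Definitions using (Injective)

record Matroid (n : ℕ) : Set₁ where
  field
    Indep     : Subset n → Set
    indep?    : (A : Subset n) → Dec (Indep A)
    indep-∅   : Indep ∅
    indep-⊆   : ∀ {A B} → A ⊆ B → Indep B → Indep A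
    indep-aug : ∀ {A B} → Indep A → Indep B → ∣ A ∣ < ∣ B ∣ →
                ∃[ x ] (x ∈ B × x ∉ A × Indep (A ∪ ⁅ x ⁆))

open Matroid public

IsRank : ∀ {n} → Matroid n → Subset n → ℕ → Set
IsRank M A r =
  (∃[ I ] (I ⊆ A × Indep M I × ∣ I ∣ ≡ r)) ×
  (∀ I → I ⊆ A → Indep M I → ∣ I ∣ ≤ r)

HasRank : ∀ {n} → Matroid n → ℕ → Set
HasRank M r = IsRank M Full r

IsFlat : ∀ {n} → Matroid n → Subset n → Set
IsFlat M F = ∀ x → x ∉ F → ∀ r r′ → IsRank M F r → IsRank M (F ∪ ⁅ x ⁆) r′ → r < r′

IsHyperplane : ∀ {n} → Matroid n → Subset n → Set
IsHyperplane M H = IsFlat M H × ∃[ r ] (HasRank M (suc r) × IsRank M H r)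

IsPoint : ∀ {n} → Matroid n → Subset n → Set
IsPoint M P = IsFlat M P × IsRank M P 1

-- simple: no loops and no parallel pairs (every set of size ≤ 2 is independent)
Simple : ∀ {n} → Matroid n → Set
Simple M = ∀ x y → Indep M (⁅ x ⁆ ∪ ⁅ y ⁆)

IsAdjoint : ∀ {n n′} → Matroid n → Matroid n′ → Set
IsAdjoint {n} {n′} M M′ =
  Simple M′ ×
  (∀ r → HasRank M r → HasRank M′ r) ×
  Σ (Subset n → Subset n′) λ φ →
    (∀ F → IsFlat M F → IsFlat M′ (φ F)) ×
    (∀ F G → IsFlat M F → IsFlat M G → φ F ≡ φ G → F ≡ G) ×
    (∀ F G → IsFlat M F → IsFlat M G → F ⊆ G → φ G ⊆ φ F) ×
    (∀ H → IsHyperplane M H → IsPoint M′ (φ H)) ×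
    (∀ P → IsPoint M′ P → ∃[ H ] (IsHyperplane M H × φ H ≡ P))

HasAdjoint : ∀ {n} → Matroid n → Set₁
HasAdjoint M = ∃[ n′ ] Σ (Matroid n′) λ M′ → IsAdjoint M M′

-- Zero-nonzero patterns: Pattern m k has m rows, k columns;
-- entry true = * (nonzero), false = 0.

Pattern : ℕ → ℕ → Set
Pattern m k = Fin m → Fin k → Bool

transpose : ∀ {m k} → Pattern m k → Pattern k m
transpose Y j i = Y i j

rowZero : ∀ {m k} → Pattern m k → Fin m → Subset k
rowZero Y i = tabulate λ j → not (Y i j)

IsFundamentalPattern : ∀ {n h} → Matroid n → Pattern h n → Set
IsFundamentalPattern M Y =
  (∀ i → IsHyperplane M (rowZero Y i)) ×
  (∀ i i′ → rowZero Y i ≡ rowZero Y i′ → i ≡ i′) ×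
  (∀ H → IsHyperplane M H → ∃[ i ] (rowZero Y i ≡ H))

InR : ∀ {m k} → Pattern m k → Matroid k → Set
InR Y N = ∀ i → IsFlat N (rowZero Y i)

IsMinRank : ∀ {m k} → Pattern m k → ℕ → Set₁
IsMinRank {m} {k} Y r =
  (Σ (Matroid k) λ N → InR Y N × HasRank N r) ×
  (∀ (N : Matroid k) r′ → InR Y N → HasRank N r′ → r ≤ r′)

HasTriangle : ∀ {m k} → Pattern m k → ℕ → Set
HasTriangle {m} {k} Y t =
  Σ (Fin t → Fin m) λ ρ → Σ (Fin t → Fin k) λ γ →
    Injective _≡_ _≡_ ρ × Injective _≡_ _≡_ γ ×
    (∀ i → Y (ρ i) (γ i) ≡ true) ×
    (∀ i j → i <ᶠ j → Y (ρ i) (γ j) ≡ false)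

IsTri : ∀ {m k} → Pattern m k → ℕ → Set
IsTri Y t = HasTriangle Y t × (∀ s → HasTriangle Y s → s ≤ t)

MrGtTri : ∀ {m k} → Pattern m k → Set₁
MrGtTri Y = ∃[ r ] ∃[ t ] (IsMinRank Y r × IsTri Y t × t < r)

-- Write r = r(M) and H_j for the hyperplane labelling column j of X.
-- A basis b₁ … b_r together with the hyperplanes cl(B - bᵢ) gives an r × r triangle in X, and
-- the rows of any triangle are independent in M (each lies outside a flat containing the
-- earlier ones), so tri(X) = r.  It remains to show that M has an adjoint iff some N ∈ R(X)
-- has rank at most r.
--
-- For an injective, inclusion-reversing map φ from the flats of M to the flats of M′ with
-- r(M′) ≤ r(M), comparing ranks along maximal chains of flats gives r(F) + r′(φ F) = r(M).
-- Given an adjoint, φ H_j is a point {p_j}; pulling M′ back along j ↦ p_j yields N of rank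
-- at most r, and for a non-loop e the zero set of row e is the preimage of the flat φ(cl e),
-- since by the rank formula φ F ⊆ φ(cl e) forces e ∈ F.  Conversely, for N ∈ R(X) of rank
-- at most r the map F ↦ {j : F ⊆ H_j} is such an embedding; the rank formula then forces
-- r(N) = r and sends hyperplanes to points, so N is an adjoint.

module Submission where

open import Defs
open import Data.Bool using (Bool; true; false; not)
open import Data.Bool.Properties using (not-injective) renaming (_≟_ to _≟ᵇ_)
open import Data.Empty using (⊥-elim)
open import Data.Fin as Fin using (Fin; zero; suc; fromℕ; inject₁; toℕ)
open import Data.Fin.Properties
  using (any?; all?; toℕ<n; toℕ-fromℕ; toℕ-inject₁; ℕ<⇒inject₁<)
  renaming (_≟_ to _≟ᶠ_; suc-injective to suc-injectiveᶠ)
open import Data.Fin.Relation.Unary.Top using (view; ‵fromℕ; ‵inj₁)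
open import Data.Fin.Subset
  using (Subset; Nonempty; _∈_; _∉_; _⊆_; _∪_; _∩_; _-_; ⁅_⁆; ∣_∣; inside; outside)
  renaming (⊥ to ∅; ⊤ to Full)
open import Data.Fin.Subset.Properties
open import Data.List using (List; []; _∷_; allFin)
import Data.List.Membership.Propositional as List
import Data.List.Relation.Unary.Any as Any
open import Data.List.Membership.Propositional.Properties using (∈-allFin)
open import Data.Nat using (ℕ; zero; suc; _<_; _≤_; z≤n; s≤s; _+_; _∸_; _≤?_; _<?_)
open import Data.Nat.Properties
open import Data.Product using (Σ; Σ-syntax; ∃; ∃-syntax; _×_; _,_; proj₁; proj₂)
open import Data.Sum using (_⊎_; inj₁; inj₂; [_,_]′)
open import Data.Unit using (⊤; tt)
open import Data.Vec using ([]; _∷_; tabulate; lookup; here; there)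
open import Data.Vec.Properties using (lookup∘tabulate; []=⇒lookup; lookup⇒[]=)
open import Function using (_∘_; case_of_)
open import Function.Bundles using (_⇔_; mk⇔; Equivalence)
open import Function.Definitions using (Injective)
open import Relation.Nullary
open import Relation.Nullary.Decidable using (dec-true; decidable-stable; map′)
open import Relation.Nullary.Reflects using (Reflects; invert)
open import Relation.Binary.PropositionalEquality

-- Subsets

does≡true⇒ : ∀ {A : Set} (a? : Dec A) → does a? ≡ true → A
does≡true⇒ a? does≡true = invert (subst (Reflects _) does≡true (proof a?))

module _ {n : ℕ} where

  ∈-tabulate⁺ : (f : Fin n → Bool) {x : Fin n} → f x ≡ true → x ∈ tabulate f
  ∈-tabulate⁺ f {x} fx = lookup⇒[]= x _ (trans (lookup∘tabulate f x) fx)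

  ∈-tabulate⁻ : (f : Fin n → Bool) {x : Fin n} → x ∈ tabulate f → f x ≡ true
  ∈-tabulate⁻ f {x} x∈ = trans (sym (lookup∘tabulate f x)) ([]=⇒lookup x∈)

  ⟦_⟧ : {P : Fin n → Set} → (∀ x → Dec (P x)) → Subset n
  ⟦ P? ⟧ = tabulate (does ∘ P?)

  module _ {P : Fin n → Set} (P? : ∀ x → Dec (P x)) {x : Fin n} where

    ∈⟦⟧⁺ : P x → x ∈ ⟦ P? ⟧
    ∈⟦⟧⁺ px = ∈-tabulate⁺ _ (dec-true (P? x) px)

    ∈⟦⟧⁻ : x ∈ ⟦ P? ⟧ → P x
    ∈⟦⟧⁻ x∈ = does≡true⇒ (P? x) (∈-tabulate⁻ _ x∈)

  ∪-lub : {A B C : Subset n} → A ⊆ C → B ⊆ C → A ∪ B ⊆ C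
  ∪-lub {A} {B} A⊆C B⊆C x∈ with x∈p∪q⁻ A B x∈
  ... | inj₁ x∈A = A⊆C x∈A
  ... | inj₂ x∈B = B⊆C x∈B

  ∪-monoˡ : {A B C : Subset n} → A ⊆ B → A ∪ C ⊆ B ∪ C
  ∪-monoˡ {C = C} A⊆B = ∪-lub (p⊆p∪q C ∘ A⊆B) (q⊆p∪q _ C)

  ⁅x⁆⊆ : {x : Fin n} {A : Subset n} → x ∈ A → ⁅ x ⁆ ⊆ A
  ⁅x⁆⊆ {x} x∈A y∈ rewrite x∈⁅y⁆⇒x≡y x y∈ = x∈A

  x∈p∪⁅x⁆ : (A : Subset n) (x : Fin n) → x ∈ A ∪ ⁅ x ⁆
  x∈p∪⁅x⁆ A x = q⊆p∪q A _ (x∈⁅x⁆ x)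

  ⊆-or-witness : (A B : Subset n) → A ⊆ B ⊎ ∃[ x ] (x ∈ A × x ∉ B)
  ⊆-or-witness A B with any? (λ x → (x ∈? A) ×-dec ¬? (x ∈? B))
  ... | yes witness = inj₂ witness
  ... | no ¬witness = inj₁ λ {x} x∈A → decidable-stable (x ∈? B) (λ x∉B → ¬witness (x , x∈A , x∉B))

  ∣p∣>0⇒nonempty : (A : Subset n) → 0 < ∣ A ∣ → Nonempty A
  ∣p∣>0⇒nonempty A 0<∣A∣ with nonempty? A
  ... | yes ne = ne
  ... | no ¬ne = ⊥-elim (<⇒≢ 0<∣A∣ (sym (trans (cong ∣_∣ (Empty-unique ¬ne)) (∣⊥∣≡0 n))))

∣p∪⁅x⁆∣≡1+∣p∣ : ∀ {n} (A : Subset n) (x : Fin n) → x ∉ A → ∣ A ∪ ⁅ x ⁆ ∣ ≡ suc ∣ A ∣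
∣p∪⁅x⁆∣≡1+∣p∣ (outside ∷ A) zero    _   = cong (suc ∘ ∣_∣) (∪-identityʳ A)
∣p∪⁅x⁆∣≡1+∣p∣ (inside ∷ A)  zero    x∉A = ⊥-elim (x∉A here)
∣p∪⁅x⁆∣≡1+∣p∣ (outside ∷ A) (suc x) x∉A = ∣p∪⁅x⁆∣≡1+∣p∣ A x (x∉A ∘ there)
∣p∪⁅x⁆∣≡1+∣p∣ (inside ∷ A)  (suc x) x∉A = cong suc (∣p∪⁅x⁆∣≡1+∣p∣ A x (x∉A ∘ there))

x∉p-x : ∀ {n} (A : Subset n) (x : Fin n) → x ∉ A - x
x∉p-x (_ ∷ A) zero    ()
x∉p-x (_ ∷ A) (suc x) (there x∈) = x∉p-x A x x∈

p-x∪⁅x⁆≡p : ∀ {n} (A : Subset n) {x : Fin n} → x ∈ A → (A - x) ∪ ⁅ x ⁆ ≡ A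
p-x∪⁅x⁆≡p A {x} x∈A = ⊆-antisym (∪-lub (p─q⊆p A _) (⁅x⁆⊆ x∈A)) A⊆
  where
  A⊆ : A ⊆ (A - x) ∪ ⁅ x ⁆
  A⊆ {y} y∈A with y ≟ᶠ x
  ... | yes refl = x∈p∪⁅x⁆ _ x
  ... | no y≢x   = p⊆p∪q _ (x∈p∧x≢y⇒x∈p-y y∈A y≢x)

∣p∣≡1+∣p-x∣ : ∀ {n} (A : Subset n) {x : Fin n} → x ∈ A → ∣ A ∣ ≡ suc ∣ A - x ∣
∣p∣≡1+∣p-x∣ A {x} x∈A = begin
  ∣ A ∣                ≡⟨ cong ∣_∣ (p-x∪⁅x⁆≡p A x∈A) ⟨
  ∣ (A - x) ∪ ⁅ x ⁆ ∣  ≡⟨ ∣p∪⁅x⁆∣≡1+∣p∣ (A - x) x (x∉p-x A x) ⟩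
  suc ∣ A - x ∣        ∎
  where open ≡-Reasoning

members : ∀ {n} (A : Subset n) → Fin ∣ A ∣ → Fin n
members (inside ∷ A)  zero    = zero
members (inside ∷ A)  (suc i) = suc (members A i)
members (outside ∷ A) i       = suc (members A i)

members-∈ : ∀ {n} (A : Subset n) i → members A i ∈ A
members-∈ (inside ∷ A)  zero    = here
members-∈ (inside ∷ A)  (suc i) = there (members-∈ A i)
members-∈ (outside ∷ A) i       = there (members-∈ A i)

members-injective : ∀ {n} (A : Subset n) → Injective _≡_ _≡_ (members A)
members-injective (inside ∷ A)  {zero}  {zero}  _  = refl
members-injective (inside ∷ A)  {suc i} {suc j} eq = cong suc (members-injective A (suc-injectiveᶠ eq))
members-injective (outside ∷ A)                 eq = members-injective A (suc-injectiveᶠ eq)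

module _ {m n : ℕ} (p : Fin m → Fin n) where

  hits? : ∀ S y → Dec (∃[ x ] (x ∈ S × p x ≡ y))
  hits? S y = any? (λ x → (x ∈? S) ×-dec (p x ≟ᶠ y))

  image : Subset m → Subset n
  image S = ⟦ hits? S ⟧

  preimage : Subset n → Subset m
  preimage F = tabulate (lookup F ∘ p)

  ∈-image⁺ : ∀ {S x} → x ∈ S → p x ∈ image S
  ∈-image⁺ {S} x∈S = ∈⟦⟧⁺ (hits? S) (_ , x∈S , refl)

  ∈-image⁻ : ∀ {S y} → y ∈ image S → ∃[ x ] (x ∈ S × p x ≡ y)
  ∈-image⁻ {S} = ∈⟦⟧⁻ (hits? S)

  image-mono : ∀ {S T} → S ⊆ T → image S ⊆ image T
  image-mono S⊆T y∈ with ∈-image⁻ y∈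
  ... | _ , x∈S , refl = ∈-image⁺ (S⊆T x∈S)

  image-∅ : image ∅ ⊆ ∅
  image-∅ y∈ with ∈-image⁻ y∈
  ... | _ , x∈∅ , _ = ⊥-elim (∉⊥ x∈∅)

  image-∪⁅x⁆ : ∀ S x → image (S ∪ ⁅ x ⁆) ≡ image S ∪ ⁅ p x ⁆
  image-∪⁅x⁆ S x = ⊆-antisym ⊆-∪ (∪-lub (image-mono (p⊆p∪q _)) (⁅x⁆⊆ (∈-image⁺ (x∈p∪⁅x⁆ S x))))
    where
    ⊆-∪ : image (S ∪ ⁅ x ⁆) ⊆ image S ∪ ⁅ p x ⁆
    ⊆-∪ y∈ with ∈-image⁻ y∈
    ... | z , z∈ , refl with x∈p∪q⁻ S _ z∈
    ...   | inj₁ z∈S = p⊆p∪q _ (∈-image⁺ z∈S)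
    ...   | inj₂ z∈x rewrite x∈⁅y⁆⇒x≡y x z∈x = x∈p∪⁅x⁆ _ (p x)

  ∈-preimage⁺ : ∀ {F x} → p x ∈ F → x ∈ preimage F
  ∈-preimage⁺ px∈F = ∈-tabulate⁺ _ ([]=⇒lookup px∈F)

  ∈-preimage⁻ : ∀ {F x} → x ∈ preimage F → p x ∈ F
  ∈-preimage⁻ x∈ = lookup⇒[]= _ _ (∈-tabulate⁻ _ x∈)

  image-preimage : ∀ F → image (preimage F) ⊆ F
  image-preimage F y∈ with ∈-image⁻ y∈
  ... | _ , x∈ , refl = ∈-preimage⁻ x∈

  module _ (p-injective : Injective _≡_ _≡_ p) where

    ∈-image⁻-injective : ∀ {S x} → p x ∈ image S → x ∈ S
    ∈-image⁻-injective px∈ with ∈-image⁻ px∈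
    ... | _ , x′∈S , px′≡px = subst (_∈ _) (p-injective px′≡px) x′∈S

    ∣image∣≡∣p∣ : ∀ S → ∣ image S ∣ ≡ ∣ S ∣
    ∣image∣≡∣p∣ S = go _ S refl
      where
      go : ∀ k S → ∣ S ∣ ≡ k → ∣ image S ∣ ≡ k
      go zero S ∣S∣≡0 = trans (cong ∣_∣ (Empty-unique empty)) (∣⊥∣≡0 n)
        where
        empty : ¬ Nonempty (image S)
        empty (_ , y∈) with ∈-image⁻ y∈
        ... | x , x∈S , _ = 0≢1+n (trans (sym ∣S∣≡0) (∣p∣≡1+∣p-x∣ S x∈S))
      go (suc k) S ∣S∣≡1+k with ∣p∣>0⇒nonempty S (subst (0 <_) (sym ∣S∣≡1+k) (s≤s z≤n))
      ... | x , x∈S = begin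
        ∣ image S ∣                     ≡⟨ cong (∣_∣ ∘ image) (p-x∪⁅x⁆≡p S x∈S) ⟨
        ∣ image ((S - x) ∪ ⁅ x ⁆) ∣     ≡⟨ cong ∣_∣ (image-∪⁅x⁆ (S - x) x) ⟩
        ∣ image (S - x) ∪ ⁅ p x ⁆ ∣     ≡⟨ ∣p∪⁅x⁆∣≡1+∣p∣ _ (p x) (x∉p-x S x ∘ ∈-image⁻-injective) ⟩
        suc ∣ image (S - x) ∣           ≡⟨ cong suc (go k (S - x) ∣S-x∣≡k) ⟩
        suc k                           ∎
        where
        open ≡-Reasoning
        ∣S-x∣≡k = suc-injective (trans (sym (∣p∣≡1+∣p-x∣ S x∈S)) ∣S∣≡1+k)

-- Matroids

module MatroidProperties {n : ℕ} (M : Matroid n) where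

  record IsBasis (A B : Subset n) : Set where
    field
      ⊆A      : B ⊆ A
      indep   : Indep M B
      maximal : ∀ {x} → x ∈ A → Indep M (B ∪ ⁅ x ⁆) → x ∈ B

  open IsBasis

  basis⇒rank : ∀ {A B} → IsBasis A B → IsRank M A ∣ B ∣
  basis⇒rank {A} {B} b = (B , ⊆A b , indep b , refl) , bounded
    where
    bounded : ∀ I → I ⊆ A → Indep M I → ∣ I ∣ ≤ ∣ B ∣
    bounded I I⊆A indI with ∣ I ∣ ≤? ∣ B ∣
    ... | yes ∣I∣≤∣B∣ = ∣I∣≤∣B∣
    ... | no ∣I∣≰∣B∣ with indep-aug M (indep b) indI (≰⇒> ∣I∣≰∣B∣)
    ...   | x , x∈I , x∉B , indBx = ⊥-elim (x∉B (maximal b (I⊆A x∈I) indBx))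

  greedy : ∀ (xs : List (Fin n)) {A I} → Indep M I → I ⊆ A →
           Σ[ J ∈ Subset n ] (I ⊆ J × J ⊆ A × Indep M J ×
             (∀ {x} → x List.∈ xs → x ∈ A → Indep M (J ∪ ⁅ x ⁆) → x ∈ J))
  greedy [] {I = I} indI I⊆A = I , ⊆-refl , I⊆A , indI , λ ()
  greedy (x ∷ xs) {A} {I} indI I⊆A with (x ∈? A) ×-dec indep? M (I ∪ ⁅ x ⁆)
  ... | yes (x∈A , indIx) =
    let J , Ix⊆J , J⊆A , indJ , maxJ = greedy xs indIx (∪-lub I⊆A (⁅x⁆⊆ x∈A))
    in J , Ix⊆J ∘ p⊆p∪q _ , J⊆A , indJ , λ where
         (Any.here refl) _ _ → Ix⊆J (x∈p∪⁅x⁆ I x)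
         (Any.there y∈xs)    → maxJ y∈xs
  ... | no ¬extends =
    let J , I⊆J , J⊆A , indJ , maxJ = greedy xs indI I⊆A
    in J , I⊆J , J⊆A , indJ , λ where
         (Any.here refl) x∈A indJx → ⊥-elim (¬extends (x∈A , indep-⊆ M (∪-monoˡ I⊆J) indJx))
         (Any.there y∈xs)          → maxJ y∈xs

  extendToBasis : ∀ {A I} → Indep M I → I ⊆ A → Σ[ B ∈ Subset n ] (I ⊆ B × IsBasis A B)
  extendToBasis indI I⊆A =
    let B , I⊆B , B⊆A , indB , maxB = greedy (allFin n) indI I⊆A
    in B , I⊆B , record { ⊆A = B⊆A ; indep = indB ; maximal = maxB (∈-allFin _) }

  basisOf : Subset n → Subset n
  basisOf A = proj₁ (extendToBasis (indep-∅ M) (⊆-min A))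

  basisOf-isBasis : ∀ A → IsBasis A (basisOf A)
  basisOf-isBasis A = proj₂ (proj₂ (extendToBasis (indep-∅ M) (⊆-min A)))

  rk : Subset n → ℕ
  rk A = ∣ basisOf A ∣

  rk-isRank : ∀ A → IsRank M A (rk A)
  rk-isRank A = basis⇒rank (basisOf-isBasis A)

  rank-mono : ∀ {A B r s} → A ⊆ B → IsRank M A r → IsRank M B s → r ≤ s
  rank-mono A⊆B ((I , I⊆A , indI , refl) , _) (_ , boundB) = boundB I (A⊆B ∘ I⊆A) indI

  rank-unique : ∀ {A r s} → IsRank M A r → IsRank M A s → r ≡ s
  rank-unique R S = ≤-antisym (rank-mono ⊆-refl R S) (rank-mono ⊆-refl S R)

  rk≡ : ∀ {A r} → IsRank M A r → rk A ≡ r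
  rk≡ = rank-unique (rk-isRank _)

  rk-mono : ∀ {A B} → A ⊆ B → rk A ≤ rk B
  rk-mono A⊆B = rank-mono A⊆B (rk-isRank _) (rk-isRank _)

  indep⇒∣∣≤rk : ∀ {I A} → Indep M I → I ⊆ A → ∣ I ∣ ≤ rk A
  indep⇒∣∣≤rk indI I⊆A = proj₂ (rk-isRank _) _ I⊆A indI

  rank-<-by-extension : ∀ {F A B x r s} → IsBasis F B → x ∉ F → Indep M (B ∪ ⁅ x ⁆) →
                        F ∪ ⁅ x ⁆ ⊆ A → IsRank M F r → IsRank M A s → r < s
  rank-<-by-extension {B = B} {x} {s = s} b x∉F indBx Fx⊆A R S =
    subst (_< s) (rank-unique (basis⇒rank b) R)
      (subst (_≤ s) (∣p∪⁅x⁆∣≡1+∣p∣ B x (x∉F ∘ ⊆A b))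
        (proj₂ S _ (Fx⊆A ∘ ∪-monoˡ (⊆A b)) indBx))

  flat⇒indep-extension : ∀ {F I x} → IsFlat M F → Indep M I → I ⊆ F → x ∉ F → Indep M (I ∪ ⁅ x ⁆)
  flat⇒indep-extension {F} {I} {x} flatF indI I⊆F x∉F with extendToBasis indI I⊆F
  ... | B , I⊆B , b with indep? M (B ∪ ⁅ x ⁆)
  ...   | yes indBx = indep-⊆ M (∪-monoˡ I⊆B) indBx
  ...   | no ¬indBx = ⊥-elim (<-irrefl refl (flatF x x∉F _ _ (basis⇒rank b) (basis⇒rank b′)))
    where
    b′ : IsBasis (F ∪ ⁅ x ⁆) B
    b′ = record
      { ⊆A      = p⊆p∪q _ ∘ ⊆A b
      ; indep   = indep b
      ; maximal = λ {y} y∈Fx indBy → case x∈p∪q⁻ F _ y∈Fx of λ where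
          (inj₁ y∈F) → maximal b y∈F indBy
          (inj₂ y∈x) → ⊥-elim (¬indBx (subst (λ z → Indep M (B ∪ ⁅ z ⁆)) (x∈⁅y⁆⇒x≡y x y∈x) indBy))
      }

  indep-extension⇒flat : ∀ {F} → (∀ {I x} → I ⊆ F → Indep M I → x ∉ F → Indep M (I ∪ ⁅ x ⁆)) → IsFlat M F
  indep-extension⇒flat {F} extends x x∉F _ _ =
    rank-<-by-extension b x∉F (extends (⊆A b) (indep b) x∉F) ⊆-refl
    where b = basisOf-isBasis F

  separated⇒flat : ∀ {S} → (∀ x → x ∉ S → ∃[ F ] (IsFlat M F × S ⊆ F × x ∉ F)) → IsFlat M S
  separated⇒flat separated = indep-extension⇒flat λ {I} {x} I⊆S indI x∉S →
    let F , flatF , S⊆F , x∉F = separated x x∉S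
    in flat⇒indep-extension flatF indI (S⊆F ∘ I⊆S) x∉F

  Full-flat : IsFlat M Full
  Full-flat x x∉Full = ⊥-elim (x∉Full ∈⊤)

  ∩-flat : ∀ {F G} → IsFlat M F → IsFlat M G → IsFlat M (F ∩ G)
  ∩-flat {F} {G} flatF flatG = separated⇒flat separated
    where
    separated : ∀ x → x ∉ F ∩ G → ∃[ H ] (IsFlat M H × F ∩ G ⊆ H × x ∉ H)
    separated x x∉F∩G with x ∈? F
    ... | no x∉F  = F , flatF , p∩q⊆p F G , x∉F
    ... | yes x∈F = G , flatG , p∩q⊆q F G , λ x∈G → x∉F∩G (x∈p∩q⁺ (x∈F , x∈G))

  flat? : ∀ F → Dec (IsFlat M F)
  flat? F = map′ (λ rk< x x∉ _ _ R R′ → subst₂ _<_ (rk≡ R) (rk≡ R′) (rk< x x∉))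
                 (λ flatF x x∉ → flatF x x∉ _ _ (rk-isRank _) (rk-isRank _))
                 (all? λ x → ¬? (x ∈? F) →-dec (rk F <? rk (F ∪ ⁅ x ⁆)))

  rk-<-flat : ∀ {F A x} → IsFlat M F → F ⊆ A → x ∈ A → x ∉ F → rk F < rk A
  rk-<-flat {F} flatF F⊆A x∈A x∉F =
    rank-<-by-extension b x∉F (flat⇒indep-extension flatF (indep b) (⊆A b) x∉F)
      (∪-lub F⊆A (⁅x⁆⊆ x∈A)) (rk-isRank _) (rk-isRank _)
    where b = basisOf-isBasis F

  flat-⊆-rk≤⇒⊇ : ∀ {F G} → IsFlat M F → F ⊆ G → rk G ≤ rk F → G ⊆ F
  flat-⊆-rk≤⇒⊇ {F} {G} flatF F⊆G rkG≤rkF with ⊆-or-witness G F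
  ... | inj₁ G⊆F = G⊆F
  ... | inj₂ (x , x∈G , x∉F) = ⊥-elim (<⇒≱ (rk-<-flat flatF F⊆G x∈G x∉F) rkG≤rkF)

  flat-between-cover : ∀ {F W G} → IsFlat M F → IsFlat M W → F ⊆ W → W ⊆ G →
                       rk G ≤ suc (rk F) → W ⊆ F ⊎ G ⊆ W
  flat-between-cover {F} {W} flatF flatW F⊆W W⊆G rkG≤ with ⊆-or-witness W F
  ... | inj₁ W⊆F = inj₁ W⊆F
  ... | inj₂ (x , x∈W , x∉F) =
    inj₂ (flat-⊆-rk≤⇒⊇ flatW W⊆G (≤-trans rkG≤ (rk-<-flat flatF F⊆W x∈W x∉F)))

  spans? : ∀ I x → Dec (x ∈ I ⊎ ¬ Indep M (I ∪ ⁅ x ⁆))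
  spans? I x = (x ∈? I) ⊎-dec ¬? (indep? M (I ∪ ⁅ x ⁆))

  -- the closure of I when I is independent
  span : Subset n → Subset n
  span I = ⟦ spans? I ⟧

  span-⊇ : ∀ I → I ⊆ span I
  span-⊇ I x∈I = ∈⟦⟧⁺ (spans? I) (inj₁ x∈I)

  ∉span⇒indep : ∀ {I x} → x ∉ span I → Indep M (I ∪ ⁅ x ⁆)
  ∉span⇒indep {I} x∉ = decidable-stable (indep? M _) (x∉ ∘ ∈⟦⟧⁺ (spans? I) ∘ inj₂)

  indep⇒∉span : ∀ {I x} → x ∉ I → Indep M (I ∪ ⁅ x ⁆) → x ∉ span I
  indep⇒∉span {I} x∉I indIx x∈ with ∈⟦⟧⁻ (spans? I) x∈
  ... | inj₁ x∈I   = x∉I x∈I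
  ... | inj₂ ¬indIx = ¬indIx indIx

  span-isBasis : ∀ {I} → Indep M I → IsBasis (span I) I
  span-isBasis {I} indI = record
    { ⊆A      = span-⊇ I
    ; indep   = indI
    ; maximal = λ {x} x∈ indIx → case ∈⟦⟧⁻ (spans? I) x∈ of λ where
        (inj₁ x∈I)    → x∈I
        (inj₂ ¬indIx) → ⊥-elim (¬indIx indIx)
    }

  rk-span : ∀ {I} → Indep M I → rk (span I) ≡ ∣ I ∣
  rk-span indI = rk≡ (basis⇒rank (span-isBasis indI))

  span-flat : ∀ {I} → Indep M I → IsFlat M (span I)
  span-flat indI x x∉ _ _ = rank-<-by-extension (span-isBasis indI) x∉ (∉span⇒indep x∉) ⊆-refl

  span-least : ∀ {F I} → IsFlat M F → Indep M I → I ⊆ F → span I ⊆ F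
  span-least {F} {I} flatF indI I⊆F {x} x∈ with x ∈? F
  ... | yes x∈F = x∈F
  ... | no x∉F with ∈⟦⟧⁻ (spans? I) x∈
  ...   | inj₁ x∈I    = I⊆F x∈I
  ...   | inj₂ ¬indIx = ⊥-elim (¬indIx (flat⇒indep-extension flatF indI I⊆F x∉F))

  basis⇒⊆span : ∀ {A B} → IsBasis A B → A ⊆ span B
  basis⇒⊆span {B = B} b {x} x∈A with indep? M (B ∪ ⁅ x ⁆)
  ... | yes indBx = span-⊇ B (maximal b x∈A indBx)
  ... | no ¬indBx = ∈⟦⟧⁺ (spans? B) (inj₂ ¬indBx)

  loops : Subset n
  loops = span ∅

  loops-flat : IsFlat M loops
  loops-flat = span-flat (indep-∅ M)

  rk-loops : rk loops ≡ 0
  rk-loops = trans (rk-span (indep-∅ M)) (∣⊥∣≡0 n)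

  loops⊆flat : ∀ {F} → IsFlat M F → loops ⊆ F
  loops⊆flat {F} flatF = span-least flatF (indep-∅ M) (⊆-min F)

  loop∈flat : ∀ {e F} → ¬ Indep M ⁅ e ⁆ → IsFlat M F → e ∈ F
  loop∈flat {e} {F} ¬indE flatF = decidable-stable (e ∈? F) λ e∉F →
    ¬indE (subst (Indep M) (∪-identityˡ _) (flat⇒indep-extension flatF (indep-∅ M) (⊆-min F) e∉F))

  join : Subset n → Fin n → Subset n
  join F x = span (basisOf F ∪ ⁅ x ⁆)

  module _ {F x} (flatF : IsFlat M F) (x∉F : x ∉ F) where

    private
      b = basisOf-isBasis F

      indBx : Indep M (basisOf F ∪ ⁅ x ⁆)
      indBx = flat⇒indep-extension flatF (indep b) (⊆A b) x∉F

    join-flat : IsFlat M (join F x)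
    join-flat = span-flat indBx

    ∈-join : x ∈ join F x
    ∈-join = span-⊇ _ (x∈p∪⁅x⁆ _ x)

    ⊆-join : F ⊆ join F x
    ⊆-join = span-least join-flat (indep b) (span-⊇ _ ∘ p⊆p∪q _) ∘ basis⇒⊆span b

    rk-join : rk (join F x) ≡ suc (rk F)
    rk-join = trans (rk-span indBx) (∣p∪⁅x⁆∣≡1+∣p∣ _ x (x∉F ∘ ⊆A b))

    join-least : ∀ {G} → IsFlat M G → F ⊆ G → x ∈ G → join F x ⊆ G
    join-least flatG F⊆G x∈G = span-least flatG indBx (∪-lub (F⊆G ∘ ⊆A b) (⁅x⁆⊆ x∈G))

  subflat-of-rank-pred : ∀ {F k} → IsFlat M F → rk F ≡ suc k →
                         Σ[ G ∈ Subset n ] (IsFlat M G × G ⊆ F × rk G ≡ k)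
  subflat-of-rank-pred {F} {k} flatF rkF≡ with ∣p∣>0⇒nonempty (basisOf F) (subst (0 <_) (sym rkF≡) (s≤s z≤n))
  ... | y , y∈B = span I , span-flat indI , span-least flatF indI (⊆A b ∘ p─q⊆p _ _) , rk≡k
    where
    b = basisOf-isBasis F
    I = basisOf F - y
    indI = indep-⊆ M (p─q⊆p _ _) (indep b)
    rk≡k = trans (rk-span indI) (suc-injective (trans (sym (∣p∣≡1+∣p-x∣ _ y∈B)) rkF≡))

  rk-hyperplane : ∀ {H} → IsHyperplane M H → suc (rk H) ≡ rk Full
  rk-hyperplane (_ , _ , R , RH) = trans (cong suc (rk≡ RH)) (sym (rk≡ R))

  module _ {B x} (b : IsBasis Full B) (x∈B : x ∈ B) where

    private
      indB-x : Indep M (B - x)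
      indB-x = indep-⊆ M (p─q⊆p _ _) (indep b)

    span-basis-x-hyperplane : IsHyperplane M (span (B - x))
    span-basis-x-hyperplane =
      span-flat indB-x , ∣ B - x ∣ ,
      subst (IsRank M Full) (∣p∣≡1+∣p-x∣ B x∈B) (basis⇒rank b) ,
      basis⇒rank (span-isBasis indB-x)

    ∉span-basis-x : x ∉ span (B - x)
    ∉span-basis-x = indep⇒∉span (x∉p-x B x) (subst (Indep M) (sym (p-x∪⁅x⁆≡p B x∈B)) (indep b))

  separating-hyperplane : ∀ {G x} → IsFlat M G → x ∉ G → ∃[ H ] (IsHyperplane M H × G ⊆ H × x ∉ H)
  separating-hyperplane {G} {x} flatG x∉G =
    span (B - x) , hyperplane ,
    span-least (proj₁ hyperplane) (indep bG) (span-⊇ _ ∘ basisG⊆B-x) ∘ basis⇒⊆span bG ,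
    ∉span-basis-x b x∈B
    where
    bG = basisOf-isBasis G
    extension = extendToBasis (flat⇒indep-extension flatG (indep bG) (⊆A bG) x∉G) (⊆-max _)
    B = proj₁ extension
    b = proj₂ (proj₂ extension)
    x∈B = proj₁ (proj₂ extension) (x∈p∪⁅x⁆ _ x)
    hyperplane = span-basis-x-hyperplane b x∈B

    basisG⊆B-x : basisOf G ⊆ B - x
    basisG⊆B-x {y} y∈ = x∈p∧x≢y⇒x∈p-y (proj₁ (proj₂ extension) (p⊆p∪q _ y∈)) λ { refl → x∉G (⊆A bG y∈) }

  simple-point : Simple M → ∀ {P} → IsRank M P 1 → ∃[ y ] (y ∈ P × ∀ {z} → z ∈ P → z ≡ y)
  simple-point simple ((I , I⊆P , _ , ∣I∣≡1) , bounded)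
    with ∣p∣>0⇒nonempty I (subst (0 <_) (sym ∣I∣≡1) (s≤s z≤n))
  ... | y , y∈I = y , I⊆P y∈I , λ {z} z∈P → decidable-stable (z ≟ᶠ y) λ z≢y →
    let ∣yz∣≡2 = trans (∣p∪⁅x⁆∣≡1+∣p∣ ⁅ y ⁆ z (z≢y ∘ x∈⁅y⁆⇒x≡y y)) (cong suc (∣⁅x⁆∣≡1 y))
        2≤1 = subst (_≤ 1) ∣yz∣≡2 (bounded _ (∪-lub (⁅x⁆⊆ (I⊆P y∈I)) (⁅x⁆⊆ z∈P)) (simple y z))
    in ≤⇒≯ 2≤1 ≤-refl

  triangle-indep : ∀ {s} (ρ : Fin s → Fin n) (F : Fin s → Subset n) → (∀ i → IsFlat M (F i)) →
                   (∀ i j → j Fin.< i → ρ j ∈ F i) → (∀ i → ρ i ∉ F i) → Indep M (image ρ Full)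
  triangle-indep {zero} ρ _ _ _ _ = indep-⊆ M (image-∅ ρ) (indep-∅ M)
  triangle-indep {suc s} ρ F flat below notAt =
    indep-⊆ M ⊆image′∪last (flat⇒indep-extension (flat last) ih image′⊆F (notAt last))
    where
    last = fromℕ s
    ρ′ = ρ ∘ inject₁

    ih : Indep M (image ρ′ Full)
    ih = triangle-indep ρ′ (F ∘ inject₁) (flat ∘ inject₁)
           (λ i j j<i → below _ _ (subst₂ _<_ (sym (toℕ-inject₁ j)) (sym (toℕ-inject₁ i)) j<i))
           (notAt ∘ inject₁)

    image′⊆F : image ρ′ Full ⊆ F last
    image′⊆F y∈ with ∈-image⁻ ρ′ y∈
    ... | j , _ , refl = below last (inject₁ j) (ℕ<⇒inject₁< (subst (toℕ j <_) (sym (toℕ-fromℕ s)) (toℕ<n j)))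

    ρ-split : ∀ i → ρ i ∈ image ρ′ Full ∪ ⁅ ρ last ⁆
    ρ-split i with view i
    ... | ‵fromℕ          = x∈p∪⁅x⁆ _ _
    ... | ‵inj₁ {i = j} _ = p⊆p∪q _ (∈-image⁺ ρ′ {x = j} ∈⊤)

    ⊆image′∪last : image ρ Full ⊆ image ρ′ Full ∪ ⁅ ρ last ⁆
    ⊆image′∪last y∈ with ∈-image⁻ ρ y∈
    ... | i , _ , refl = ρ-split i

module Pullback {m n : ℕ} (p : Fin m → Fin n) (p-injective : Injective _≡_ _≡_ p) (M : Matroid n) where

  pullback : Matroid m
  pullback = record
    { Indep     = Indep M ∘ image p
    ; indep?    = indep? M ∘ image p
    ; indep-∅   = indep-⊆ M (image-∅ p) (indep-∅ M)
    ; indep-⊆   = indep-⊆ M ∘ image-mono p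
    ; indep-aug = augment
    }
    where
    augment : ∀ {A B} → Indep M (image p A) → Indep M (image p B) → ∣ A ∣ < ∣ B ∣ →
              ∃[ x ] (x ∈ B × x ∉ A × Indep M (image p (A ∪ ⁅ x ⁆)))
    augment {A} {B} indA indB ∣A∣<∣B∣
      with indep-aug M indA indB
             (subst₂ _<_ (sym (∣image∣≡∣p∣ p p-injective A)) (sym (∣image∣≡∣p∣ p p-injective B)) ∣A∣<∣B∣)
    ... | y , y∈B , y∉A , indAy with ∈-image⁻ p y∈B
    ...   | x , x∈B , refl =
      x , x∈B , y∉A ∘ ∈-image⁺ p , subst (Indep M) (sym (image-∪⁅x⁆ p A x)) indAy

  preimage-flat : ∀ {F} → IsFlat M F → IsFlat pullback (preimage p F)
  preimage-flat {F} flatF = MatroidProperties.indep-extension⇒flat pullback λ {I} {x} I⊆ indI x∉ →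
    subst (Indep M) (sym (image-∪⁅x⁆ p I x))
      (MatroidProperties.flat⇒indep-extension M flatF indI
        (image-preimage p F ∘ image-mono p I⊆) (x∉ ∘ ∈-preimage⁺ p))

  rk-pullback≤ : MatroidProperties.rk pullback Full ≤ MatroidProperties.rk M Full
  rk-pullback≤ = subst (_≤ _) (∣image∣≡∣p∣ p p-injective B)
                   (MatroidProperties.indep⇒∣∣≤rk M (IsBasis.indep b) ⊆⊤)
    where
    open MatroidProperties pullback using (basisOf; basisOf-isBasis; IsBasis)
    B = basisOf Full
    b = basisOf-isBasis Full

-- Injective order-reversing maps between lattices of flats

module FlatReversal {n n′ : ℕ} (M : Matroid n) (M′ : Matroid n′) (φ : Subset n → Subset n′)
  (φ-flat : ∀ F → IsFlat M F → IsFlat M′ (φ F))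
  (φ-injective : ∀ F G → IsFlat M F → IsFlat M G → φ F ≡ φ G → F ≡ G)
  (φ-antitone : ∀ F G → IsFlat M F → IsFlat M G → F ⊆ G → φ G ⊆ φ F) where

  open MatroidProperties M
  module P′ = MatroidProperties M′

  φ-rk-< : ∀ {F G x} → IsFlat M F → IsFlat M G → F ⊆ G → x ∈ G → x ∉ F → P′.rk (φ G) < P′.rk (φ F)
  φ-rk-< {F} {G} {x} flatF flatG F⊆G x∈G x∉F with ⊆-or-witness (φ F) (φ G)
  ... | inj₁ φF⊆φG =
    ⊥-elim (x∉F (subst (x ∈_) (sym (φ-injective F G flatF flatG (⊆-antisym φF⊆φG φG⊆φF))) x∈G))
    where φG⊆φF = φ-antitone F G flatF flatG F⊆G
  ... | inj₂ (y , y∈φF , y∉φG) =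
    P′.rk-<-flat (φ-flat G flatG) (φ-antitone F G flatF flatG F⊆G) y∈φF y∉φG

  φ-rk-chain : ∀ d {F G} → IsFlat M F → IsFlat M G → F ⊆ G → rk F + d ≡ rk G →
               P′.rk (φ G) + d ≤ P′.rk (φ F)
  φ-rk-chain zero {F} {G} flatF flatG F⊆G rk≡
    with ⊆-antisym F⊆G (flat-⊆-rk≤⇒⊇ flatF F⊆G (≤-reflexive (trans (sym rk≡) (+-identityʳ _))))
  ... | refl = ≤-reflexive (+-identityʳ _)
  φ-rk-chain (suc d) {F} {G} flatF flatG F⊆G rk≡ with ⊆-or-witness G F
  ... | inj₁ G⊆F = ⊥-elim (<⇒≱ (≤-trans (m≤m+n _ d) (≤-reflexive (trans (sym (+-suc _ d)) rk≡))) (rk-mono G⊆F))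
  ... | inj₂ (x , x∈G , x∉F) = begin
    P′.rk (φ G) + suc d    ≡⟨ +-suc _ d ⟩
    suc (P′.rk (φ G) + d)  ≤⟨ s≤s (φ-rk-chain d flatF′ flatG F′⊆G rkF′+d≡) ⟩
    suc (P′.rk (φ F′))     ≤⟨ φ-rk-< flatF flatF′ (⊆-join flatF x∉F) (∈-join flatF x∉F) x∉F ⟩
    P′.rk (φ F)            ∎
    where
    open ≤-Reasoning
    F′ = join F x
    flatF′ = join-flat flatF x∉F
    F′⊆G = join-least flatF x∉F flatG F⊆G x∈G
    rkF′+d≡ : rk F′ + d ≡ rk G
    rkF′+d≡ = trans (cong (_+ d) (rk-join flatF x∉F)) (trans (sym (+-suc _ d)) rk≡)

  module _ (rk′≤rk : P′.rk Full ≤ rk Full) where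

    rk+rk-φ≡rk : ∀ {F} → IsFlat M F → rk F + P′.rk (φ F) ≡ rk Full
    rk+rk-φ≡rk {F} flatF = ≤-antisym upper lower
      where
      upper : rk F + P′.rk (φ F) ≤ rk Full
      upper = begin
        rk F + P′.rk (φ F)  ≡⟨ +-comm (rk F) _ ⟩
        P′.rk (φ F) + rk F  ≤⟨ φ-rk-chain (rk F) loops-flat flatF (loops⊆flat flatF) (cong (_+ rk F) rk-loops) ⟩
        P′.rk (φ loops)     ≤⟨ P′.rk-mono ⊆⊤ ⟩
        P′.rk Full          ≤⟨ rk′≤rk ⟩
        rk Full             ∎
        where open ≤-Reasoning

      rkF≤ : rk F ≤ rk Full
      rkF≤ = rk-mono ⊆⊤

      lower : rk Full ≤ rk F + P′.rk (φ F)
      lower = begin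
        rk Full                                     ≡⟨ m+[n∸m]≡n rkF≤ ⟨
        rk F + (rk Full ∸ rk F)                     ≤⟨ +-monoʳ-≤ (rk F) (m≤n+m _ _) ⟩
        rk F + (P′.rk (φ Full) + (rk Full ∸ rk F))  ≤⟨ +-monoʳ-≤ (rk F) chain ⟩
        rk F + P′.rk (φ F)                          ∎
        where
        open ≤-Reasoning
        chain = φ-rk-chain _ flatF Full-flat ⊆⊤ (m+[n∸m]≡n rkF≤)

    φ-rk-shift : ∀ {F G d} → IsFlat M F → IsFlat M G → rk G ≡ d + rk F → P′.rk (φ F) ≡ d + P′.rk (φ G)
    φ-rk-shift {F} {G} {d} flatF flatG rkG≡ = +-cancelˡ-≡ (rk F) _ _ (begin
      rk F + P′.rk (φ F)        ≡⟨ rk+rk-φ≡rk flatF ⟩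
      rk Full                   ≡⟨ rk+rk-φ≡rk flatG ⟨
      rk G + P′.rk (φ G)        ≡⟨ cong (_+ P′.rk (φ G)) (trans rkG≡ (+-comm d (rk F))) ⟩
      rk F + d + P′.rk (φ G)    ≡⟨ +-assoc (rk F) d _ ⟩
      rk F + (d + P′.rk (φ G))  ∎)
      where open ≡-Reasoning

    module _ {e} (indE : Indep M ⁅ e ⁆) where

      private
        P = span ⁅ e ⁆
        flatP = span-flat indE

        rkP : rk P ≡ 1
        rkP = trans (rk-span indE) (∣⁅x⁆∣≡1 e)

      φ-atom-⊈-step : ∀ {F G} → IsFlat M F → IsFlat M G → G ⊆ F → rk F ≡ suc (rk G) → e ∉ F →
                      ¬ φ G ⊆ φ P → ¬ φ F ⊆ φ P
      φ-atom-⊈-step {F} {G} flatF flatG G⊆F rkF≡ e∉F φG⊈φP φF⊆φP =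
        [ W⊈φQ , (λ φG⊆W → φG⊈φP (λ y∈ → p∩q⊆p (φ P) (φ G) (φG⊆W y∈))) ]′
          (P′.flat-between-cover (φ-flat Q flatQ) flatW φQ⊆W (p∩q⊆q (φ P) (φ G)) (≤-reflexive rkφG≡))
        where
        e∉G = e∉F ∘ G⊆F
        Q = join G e
        flatQ = join-flat flatG e∉G
        W = φ P ∩ φ G
        flatW = P′.∩-flat (φ-flat P flatP) (φ-flat G flatG)

        φQ⊆W : φ Q ⊆ W
        φQ⊆W y∈ = x∈p∩q⁺ ( φ-antitone P Q flatP flatQ (span-least flatQ indE (⁅x⁆⊆ (∈-join flatG e∉G))) y∈
                          , φ-antitone G Q flatG flatQ (⊆-join flatG e∉G) y∈)

        rkφG≡ : P′.rk (φ G) ≡ 1 + P′.rk (φ Q)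
        rkφG≡ = φ-rk-shift flatG flatQ (rk-join flatG e∉G)

        W⊈φQ : ¬ W ⊆ φ Q
        W⊈φQ W⊆φQ = e∉F (subst (e ∈_) (sym F≡Q) (∈-join flatG e∉G))
          where
          φF⊆φQ : φ F ⊆ φ Q
          φF⊆φQ y∈ = W⊆φQ (x∈p∩q⁺ (φF⊆φP y∈ , φ-antitone G F flatG flatF G⊆F y∈))
          rkφF≡ : P′.rk (φ F) ≡ 0 + P′.rk (φ Q)
          rkφF≡ = φ-rk-shift flatF flatQ (trans (rk-join flatG e∉G) (sym rkF≡))
          F≡Q : F ≡ Q
          F≡Q = φ-injective F Q flatF flatQ
            (⊆-antisym φF⊆φQ (P′.flat-⊆-rk≤⇒⊇ (φ-flat F flatF) φF⊆φQ (≤-reflexive (sym rkφF≡))))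

      φ-atom-⊈ : ∀ k {F} → IsFlat M F → rk F ≡ k → e ∉ F → ¬ φ F ⊆ φ P
      φ-atom-⊈ zero {F} flatF rkF≡0 _ φF⊆φP =
        <-irrefl refl (≤-trans (≤-reflexive (sym rkφF≡)) (P′.rk-mono φF⊆φP))
        where
        rkφF≡ : P′.rk (φ F) ≡ 1 + P′.rk (φ P)
        rkφF≡ = φ-rk-shift flatF flatP (trans rkP (cong suc (sym rkF≡0)))
      φ-atom-⊈ (suc k) flatF rkF≡ e∉F =
        let G , flatG , G⊆F , rkG≡k = subflat-of-rank-pred flatF rkF≡
        in φ-atom-⊈-step flatF flatG G⊆F (trans rkF≡ (cong suc (sym rkG≡k))) e∉F
             (φ-atom-⊈ k flatG rkG≡k (e∉F ∘ G⊆F))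

-- Patterns

module _ {m k : ℕ} (Y : Pattern m k) {i : Fin m} {x : Fin k} where

  ∈-rowZero⁺ : Y i x ≡ false → x ∈ rowZero Y i
  ∈-rowZero⁺ Yix≡false = ∈-tabulate⁺ _ (cong not Yix≡false)

  ∈-rowZero⁻ : x ∈ rowZero Y i → Y i x ≡ false
  ∈-rowZero⁻ x∈ = not-injective (∈-tabulate⁻ _ x∈)

  ∉-rowZero⁺ : Y i x ≡ true → x ∉ rowZero Y i
  ∉-rowZero⁺ Yix≡true x∈ with () ← trans (sym Yix≡true) (∈-rowZero⁻ x∈)

  ∉-rowZero⁻ : x ∉ rowZero Y i → Y i x ≡ true
  ∉-rowZero⁻ x∉ with Y i x in Yix
  ... | true  = refl
  ... | false = ⊥-elim (x∉ (∈-rowZero⁺ Yix))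

MinRank≤ : ∀ {m k} → Pattern m k → ℕ → Set₁
MinRank≤ {k = k} Y r = Σ[ N ∈ Matroid k ] (InR Y N × MatroidProperties.rk N Full ≤ r)

module FundamentalPattern {n h} (M : Matroid n) (X : Pattern n h) (fp : IsFundamentalPattern M (transpose X)) where

  open MatroidProperties M

  r : ℕ
  r = rk Full

  hyperplane : Fin h → Subset n
  hyperplane = rowZero (transpose X)

  hyperplane-isHyperplane : ∀ j → IsHyperplane M (hyperplane j)
  hyperplane-isHyperplane = proj₁ fp

  hyperplane-flat : ∀ j → IsFlat M (hyperplane j)
  hyperplane-flat = proj₁ ∘ hyperplane-isHyperplane

  hyperplane-surjective : ∀ {H} → IsHyperplane M H → ∃[ j ] (hyperplane j ≡ H)
  hyperplane-surjective = proj₂ (proj₂ fp) _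

  hyperplane-⊆⇒≡ : ∀ {i j} → hyperplane i ⊆ hyperplane j → i ≡ j
  hyperplane-⊆⇒≡ {i} {j} Hi⊆Hj = proj₁ (proj₂ fp) i j (⊆-antisym Hi⊆Hj
    (flat-⊆-rk≤⇒⊇ (hyperplane-flat i) Hi⊆Hj (≤-reflexive (suc-injective (trans
      (rk-hyperplane (hyperplane-isHyperplane j)) (sym (rk-hyperplane (hyperplane-isHyperplane i))))))))

  ∈-hyperplane⇔ : ∀ {e j} → e ∈ hyperplane j ⇔ j ∈ rowZero X e
  ∈-hyperplane⇔ = mk⇔ (∈-rowZero⁺ X ∘ ∈-rowZero⁻ (transpose X)) (∈-rowZero⁺ (transpose X) ∘ ∈-rowZero⁻ X)

  rank-triangle : HasTriangle X r
  rank-triangle = b , γ , members-injective B , γ-injective , diagonal , above-diagonal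
    where
    B = basisOf Full
    b = members B

    γ-spec : ∀ i → ∃[ j ] (hyperplane j ≡ span (B - b i))
    γ-spec i = hyperplane-surjective (span-basis-x-hyperplane (basisOf-isBasis Full) (members-∈ B i))

    γ : Fin r → Fin h
    γ = proj₁ ∘ γ-spec

    b∉Hγ : ∀ i → b i ∉ hyperplane (γ i)
    b∉Hγ i = ∉span-basis-x (basisOf-isBasis Full) (members-∈ B i) ∘ subst (b i ∈_) (proj₂ (γ-spec i))

    b∈Hγ : ∀ i j → i ≢ j → b i ∈ hyperplane (γ j)
    b∈Hγ i j i≢j = subst (b i ∈_) (sym (proj₂ (γ-spec j)))
      (span-⊇ _ (x∈p∧x≢y⇒x∈p-y (members-∈ B i) (i≢j ∘ members-injective B)))

    γ-injective : Injective _≡_ _≡_ γ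
    γ-injective {i} {j} γi≡γj = decidable-stable (i ≟ᶠ j) λ i≢j →
      b∉Hγ i (subst (λ k → b i ∈ hyperplane k) (sym γi≡γj) (b∈Hγ i j i≢j))

    diagonal : ∀ i → X (b i) (γ i) ≡ true
    diagonal i = ∉-rowZero⁻ (transpose X) (b∉Hγ i)

    above-diagonal : ∀ i j → i Fin.< j → X (b i) (γ j) ≡ false
    above-diagonal i j i<j = ∈-rowZero⁻ (transpose X) (b∈Hγ i j (<⇒≢ i<j ∘ cong toℕ))

  triangle≤rank : ∀ {s} → HasTriangle X s → s ≤ r
  triangle≤rank {s} (ρ , γ , ρ-injective , _ , diagonal , above-diagonal) =
    subst (_≤ r) (trans (∣image∣≡∣p∣ ρ ρ-injective Full) (∣⊤∣≡n s))
      (indep⇒∣∣≤rk (triangle-indep ρ (hyperplane ∘ γ) (hyperplane-flat ∘ γ)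
        (λ i j j<i → ∈-rowZero⁺ (transpose X) (above-diagonal j i j<i))
        (λ i → ∉-rowZero⁺ (transpose X) (diagonal i))) ⊆⊤)

  tri≡rank : IsTri X r
  tri≡rank = rank-triangle , λ _ → triangle≤rank

  module FromAdjoint {n′} {M′ : Matroid n′} (simple : Simple M′) (rkM′≡r : MatroidProperties.rk M′ Full ≡ r)
    (φ : Subset n → Subset n′)
    (φ-flat : ∀ F → IsFlat M F → IsFlat M′ (φ F))
    (φ-injective : ∀ F G → IsFlat M F → IsFlat M G → φ F ≡ φ G → F ≡ G)
    (φ-antitone : ∀ F G → IsFlat M F → IsFlat M G → F ⊆ G → φ G ⊆ φ F)
    (φ-hyperplane : ∀ H → IsHyperplane M H → IsPoint M′ (φ H)) where

    open FlatReversal M M′ φ φ-flat φ-injective φ-antitone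

    point : ∀ j → ∃[ y ] (y ∈ φ (hyperplane j) × ∀ {z} → z ∈ φ (hyperplane j) → z ≡ y)
    point j = P′.simple-point simple (proj₂ (φ-hyperplane _ (hyperplane-isHyperplane j)))

    p : Fin h → Fin n′
    p = proj₁ ∘ point

    p∈ : ∀ j → p j ∈ φ (hyperplane j)
    p∈ = proj₁ ∘ proj₂ ∘ point

    φhyperplane⊆ : ∀ {j W} → p j ∈ W → φ (hyperplane j) ⊆ W
    φhyperplane⊆ {j} pj∈W z∈ = subst (_∈ _) (sym (proj₂ (proj₂ (point j)) z∈)) pj∈W

    p-injective : Injective _≡_ _≡_ p
    p-injective {i} {j} pi≡pj =
      hyperplane-⊆⇒≡ (⊆-reflexive (φ-injective _ _ (hyperplane-flat i) (hyperplane-flat j) (⊆-antisym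
        (φhyperplane⊆ (subst (_∈ _) (sym pi≡pj) (p∈ j)))
        (φhyperplane⊆ (subst (_∈ _) pi≡pj (p∈ i))))))

    open Pullback p p-injective M′

    rowZero≡preimage : ∀ {e} → (indE : Indep M ⁅ e ⁆) → rowZero X e ≡ preimage p (φ (span ⁅ e ⁆))
    rowZero≡preimage {e} indE = ⊆-antisym (∈-preimage⁺ p ∘ to) (from ∘ ∈-preimage⁻ p)
      where
      to : ∀ {j} → j ∈ rowZero X e → p j ∈ φ (span ⁅ e ⁆)
      to {j} j∈ = φ-antitone _ _ (span-flat indE) (hyperplane-flat j)
        (span-least (hyperplane-flat j) indE (⁅x⁆⊆ (Equivalence.from ∈-hyperplane⇔ j∈))) (p∈ j)
      from : ∀ {j} → p j ∈ φ (span ⁅ e ⁆) → j ∈ rowZero X e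
      from {j} pj∈ = Equivalence.to ∈-hyperplane⇔ (decidable-stable (e ∈? hyperplane j) λ e∉ →
        φ-atom-⊈ (≤-reflexive rkM′≡r) indE _ (hyperplane-flat j) refl e∉ (φhyperplane⊆ pj∈))

    rowZero-flat : InR X pullback
    rowZero-flat e with indep? M ⁅ e ⁆
    ... | yes indE =
      subst (IsFlat pullback) (sym (rowZero≡preimage indE)) (preimage-flat (φ-flat _ (span-flat indE)))
    ... | no ¬indE = λ j j∉ → ⊥-elim (j∉ (Equivalence.to ∈-hyperplane⇔ (loop∈flat ¬indE (hyperplane-flat j))))

    minRank≤r : MinRank≤ X r
    minRank≤r = pullback , rowZero-flat , ≤-trans rk-pullback≤ (≤-reflexive rkM′≡r)

  module ToAdjoint (N : Matroid h) (rows-flat : InR X N) (rkN≤r : MatroidProperties.rk N Full ≤ r) where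

    module Pᴺ = MatroidProperties N

    containing? : ∀ F j → Dec (F ⊆ hyperplane j)
    containing? F j = F ⊆? hyperplane j

    ψ : Subset n → Subset h
    ψ F = ⟦ containing? F ⟧

    ∈ψ⁺ : ∀ {F j} → F ⊆ hyperplane j → j ∈ ψ F
    ∈ψ⁺ {F} = ∈⟦⟧⁺ (containing? F)

    ∈ψ⁻ : ∀ {F j} → j ∈ ψ F → F ⊆ hyperplane j
    ∈ψ⁻ {F} = ∈⟦⟧⁻ (containing? F)

    ψ-flat : ∀ F → IsFlat N (ψ F)
    ψ-flat F = Pᴺ.separated⇒flat separated
      where
      separated : ∀ j → j ∉ ψ F → ∃[ Z ] (IsFlat N Z × ψ F ⊆ Z × j ∉ Z)
      separated j j∉ with ⊆-or-witness F (hyperplane j)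
      ... | inj₁ F⊆Hj = ⊥-elim (j∉ (∈ψ⁺ F⊆Hj))
      ... | inj₂ (e , e∈F , e∉Hj) =
        rowZero X e , rows-flat e , (λ i∈ → Equivalence.to ∈-hyperplane⇔ (∈ψ⁻ i∈ e∈F)) ,
        e∉Hj ∘ Equivalence.from ∈-hyperplane⇔

    ψ-antitone : ∀ F G → IsFlat M F → IsFlat M G → F ⊆ G → ψ G ⊆ ψ F
    ψ-antitone _ _ _ _ F⊆G j∈ = ∈ψ⁺ (∈ψ⁻ j∈ ∘ F⊆G)

    ψ-reflects-⊆ : ∀ {F G} → IsFlat M G → ψ G ⊆ ψ F → F ⊆ G
    ψ-reflects-⊆ {F} {G} flatG ψG⊆ψF {x} x∈F = decidable-stable (x ∈? G) λ x∉G →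
      let _ , H , G⊆H , x∉H = separating-hyperplane flatG x∉G
          j , Hj≡H = hyperplane-surjective H
      in x∉H (subst (x ∈_) Hj≡H (∈ψ⁻ (ψG⊆ψF (∈ψ⁺ (subst (G ⊆_) (sym Hj≡H) G⊆H))) x∈F))

    ψ-injective : ∀ F G → IsFlat M F → IsFlat M G → ψ F ≡ ψ G → F ≡ G
    ψ-injective F G flatF flatG ψF≡ψG =
      ⊆-antisym (ψ-reflects-⊆ flatG (⊆-reflexive (sym ψF≡ψG))) (ψ-reflects-⊆ flatF (⊆-reflexive ψF≡ψG))

    open FlatReversal M N ψ (λ F _ → ψ-flat F) ψ-injective ψ-antitone

    rk+rk-ψ≡r : ∀ {F} → IsFlat M F → rk F + Pᴺ.rk (ψ F) ≡ r
    rk+rk-ψ≡r = rk+rk-φ≡rk rkN≤r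

    rkN≡r : Pᴺ.rk Full ≡ r
    rkN≡r = ≤-antisym rkN≤r (begin
      r                           ≡⟨ rk+rk-ψ≡r loops-flat ⟨
      rk loops + Pᴺ.rk (ψ loops)  ≡⟨ cong (_+ Pᴺ.rk (ψ loops)) rk-loops ⟩
      Pᴺ.rk (ψ loops)             ≤⟨ Pᴺ.rk-mono ⊆⊤ ⟩
      Pᴺ.rk Full                  ∎)
      where open ≤-Reasoning

    rk-ψ-hyperplane : ∀ {H} → IsHyperplane M H → Pᴺ.rk (ψ H) ≡ 1
    rk-ψ-hyperplane {H} hypH = +-cancelˡ-≡ (rk H) _ _
      (trans (rk+rk-ψ≡r (proj₁ hypH)) (trans (sym (rk-hyperplane hypH)) (+-comm 1 (rk H))))

    ψ-hyperplane-point : ∀ H → IsHyperplane M H → IsPoint N (ψ H)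
    ψ-hyperplane-point H hypH = ψ-flat H , subst (IsRank N (ψ H)) (rk-ψ-hyperplane hypH) (Pᴺ.rk-isRank _)

    ∈ψhyperplane⇒≡ : ∀ {i j} → i ∈ ψ (hyperplane j) → i ≡ j
    ∈ψhyperplane⇒≡ i∈ = sym (hyperplane-⊆⇒≡ (∈ψ⁻ i∈))

    ∉ψFull : ∀ i → i ∉ ψ Full
    ∉ψFull i i∈ = <⇒≱ (≤-reflexive (rk-hyperplane (hyperplane-isHyperplane i))) (rk-mono (∈ψ⁻ i∈))

    indep-singleton : ∀ i → Indep N ⁅ i ⁆
    indep-singleton i = subst (Indep N) (∪-identityˡ _)
      (Pᴺ.flat⇒indep-extension (ψ-flat Full) (indep-∅ N) (⊆-min _) (∉ψFull i))

    N-simple : Simple N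
    N-simple i j with j ≟ᶠ i
    ... | yes refl = subst (Indep N) (sym (∪-idem ⁅ i ⁆)) (indep-singleton i)
    ... | no j≢i   = Pᴺ.flat⇒indep-extension (ψ-flat (hyperplane i)) (indep-singleton i)
                       (⁅x⁆⊆ (∈ψ⁺ ⊆-refl)) (j≢i ∘ ∈ψhyperplane⇒≡)

    ψ-onto-points : ∀ P → IsPoint N P → ∃[ H ] (IsHyperplane M H × ψ H ≡ P)
    ψ-onto-points P (_ , rankP@((I , I⊆P , _ , ∣I∣≡1) , _))
      with j , j∈I ← ∣p∣>0⇒nonempty I (subst (0 <_) (sym ∣I∣≡1) (s≤s z≤n)) =
      hyperplane j , hyperplane-isHyperplane j ,
      ⊆-antisym ψHj⊆P (Pᴺ.flat-⊆-rk≤⇒⊇ (ψ-flat (hyperplane j)) ψHj⊆P rkP≤rkψHj)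
      where
      ψHj⊆P : ψ (hyperplane j) ⊆ P
      ψHj⊆P i∈ = subst (_∈ P) (sym (∈ψhyperplane⇒≡ i∈)) (I⊆P j∈I)
      rkP≤rkψHj : Pᴺ.rk P ≤ Pᴺ.rk (ψ (hyperplane j))
      rkP≤rkψHj = ≤-reflexive (trans (Pᴺ.rk≡ rankP) (sym (rk-ψ-hyperplane (hyperplane-isHyperplane j))))

    isAdjoint : IsAdjoint M N
    isAdjoint =
      N-simple ,
      (λ r′ R → subst (HasRank N) (trans rkN≡r (rk≡ R)) (Pᴺ.rk-isRank Full)) ,
      ψ , (λ F _ → ψ-flat F) , ψ-injective , ψ-antitone , ψ-hyperplane-point , ψ-onto-points

  hasAdjoint⇔minRank≤r : HasAdjoint M ⇔ MinRank≤ X r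
  hasAdjoint⇔minRank≤r = mk⇔
    (λ (_ , M′ , simple , rank≡ , φ , φ-flat , φ-injective , φ-antitone , φ-hyperplane , _) →
      FromAdjoint.minRank≤r simple (MatroidProperties.rk≡ M′ (rank≡ r (rk-isRank Full)))
        φ φ-flat φ-injective φ-antitone φ-hyperplane)
    (λ (N , rows-flat , rkN≤r) → h , N , ToAdjoint.isAdjoint N rows-flat rkN≤r)

-- Existence of mr R(Y)

least-witness : ∀ {ℓ} {P : ℕ → Set ℓ} → (∀ k → Dec (P k)) → (∀ {j k} → j ≤ k → P j → P k) →
                ∀ {k} → P k → Σ[ m ∈ ℕ ] (P m × ∀ {j} → j < m → ¬ P j)
least-witness P? mono {zero}  P0 = zero , P0 , λ ()
least-witness P? mono {suc k} Pk+1 with P? k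
... | yes Pk = least-witness P? mono Pk
... | no ¬Pk = suc k , Pk+1 , λ j<1+k Pj → ¬Pk (mono (≤-pred j<1+k) Pj)

-- mr R(Y) is found by searching all matroids on Fin k, each encoded by the table of its independent sets.
data Table : ℕ → Set where
  leaf : Bool → Table 0
  node : ∀ {m} → Table m → Table m → Table (suc m)

lookupᵗ : ∀ {m} → Table m → Subset m → Bool
lookupᵗ (leaf b)     []          = b
lookupᵗ (node t₀ t₁) (false ∷ A) = lookupᵗ t₀ A
lookupᵗ (node t₀ t₁) (true ∷ A)  = lookupᵗ t₁ A

tabulateᵗ : ∀ {m} → (Subset m → Bool) → Table m
tabulateᵗ {zero}  f = leaf (f [])
tabulateᵗ {suc m} f = node (tabulateᵗ (f ∘ (false ∷_))) (tabulateᵗ (f ∘ (true ∷_)))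

lookupᵗ∘tabulateᵗ : ∀ {m} (f : Subset m → Bool) A → lookupᵗ (tabulateᵗ f) A ≡ f A
lookupᵗ∘tabulateᵗ {zero}  f []          = refl
lookupᵗ∘tabulateᵗ {suc m} f (false ∷ A) = lookupᵗ∘tabulateᵗ (f ∘ (false ∷_)) A
lookupᵗ∘tabulateᵗ {suc m} f (true ∷ A)  = lookupᵗ∘tabulateᵗ (f ∘ (true ∷_)) A

anyTable? : ∀ {ℓ} m {P : Table m → Set ℓ} → (∀ t → Dec (P t)) → Dec (∃ P)
anyTable? zero P? with P? (leaf true) | P? (leaf false)
... | yes p | _     = yes (_ , p)
... | no _  | yes p = yes (_ , p)
... | no ¬p | no ¬q = no λ where
  (leaf true  , p) → ¬p p
  (leaf false , q) → ¬q q
anyTable? (suc m) P? with anyTable? m (λ t₀ → anyTable? m (λ t₁ → P? (node t₀ t₁)))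
... | yes (_ , _ , p) = yes (_ , p)
... | no ¬p = no λ where
  (node t₀ t₁ , p) → ¬p (t₀ , t₁ , p)

allSubsets? : ∀ {m} {P : Subset m → Set} → (∀ A → Dec (P A)) → Dec (∀ A → P A)
allSubsets? P? with anySubset? (¬? ∘ P?)
... | yes (A , ¬PA) = no λ ∀P → ¬PA (∀P A)
... | no ¬∃¬P       = yes λ A → decidable-stable (P? A) (¬∃¬P ∘ (A ,_))

module _ {m : ℕ} {N N′ : Matroid m} (same : ∀ A → Indep N A ⇔ Indep N′ A) where

  private
    to   = λ {A} → Equivalence.to (same A)
    from = λ {A} → Equivalence.from (same A)

  rank-transfer : ∀ {A r} → IsRank N A r → IsRank N′ A r
  rank-transfer ((I , I⊆A , indI , ∣I∣≡r) , bounded) =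
    (I , I⊆A , to indI , ∣I∣≡r) , λ J J⊆A → bounded J J⊆A ∘ from

  flat-transfer : ∀ {F} → IsFlat N F → IsFlat N′ F
  flat-transfer flatF x x∉F r r′ R R′ = flatF x x∉F r r′ (rank-transfer⁻ R) (rank-transfer⁻ R′)
    where
    rank-transfer⁻ : ∀ {A r} → IsRank N′ A r → IsRank N A r
    rank-transfer⁻ ((I , I⊆A , indI , ∣I∣≡r) , bounded) =
      (I , I⊆A , from indI , ∣I∣≡r) , λ J J⊆A → bounded J J⊆A ∘ to

  rk-transfer : ∀ A → MatroidProperties.rk N′ A ≡ MatroidProperties.rk N A
  rk-transfer A = MatroidProperties.rk≡ N′ (rank-transfer (MatroidProperties.rk-isRank N A))

module MinRank {m k : ℕ} (Y : Pattern m k) where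

  Member : Table k → Subset k → Set
  Member t A = lookupᵗ t A ≡ true

  member? : ∀ t A → Dec (Member t A)
  member? t A = lookupᵗ t A ≟ᵇ true

  MatroidAxioms : Table k → Set
  MatroidAxioms t =
    Member t ∅ ×
    (∀ A B → A ⊆ B → Member t B → Member t A) ×
    (∀ A B → Member t A → Member t B → ∣ A ∣ < ∣ B ∣ → ∃[ x ] (x ∈ B × x ∉ A × Member t (A ∪ ⁅ x ⁆)))

  matroidAxioms? : ∀ t → Dec (MatroidAxioms t)
  matroidAxioms? t =
    member? t ∅ ×-dec
    allSubsets? (λ A → allSubsets? λ B → A ⊆? B →-dec member? t B →-dec member? t A) ×-dec
    allSubsets? (λ A → allSubsets? λ B → member? t A →-dec member? t B →-dec ∣ A ∣ <? ∣ B ∣ →-dec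
      any? λ x → (x ∈? B) ×-dec ¬? (x ∈? A) ×-dec member? t (A ∪ ⁅ x ⁆))

  fromTable : ∀ t → MatroidAxioms t → Matroid k
  fromTable t (indep-∅ , indep-⊆ , indep-aug) = record
    { Indep     = Member t
    ; indep?    = member? t
    ; indep-∅   = indep-∅
    ; indep-⊆   = indep-⊆ _ _
    ; indep-aug = indep-aug _ _
    }

  toTable : Matroid k → Table k
  toTable N = tabulateᵗ (does ∘ indep? N)

  indep⇔member : ∀ N A → Indep N A ⇔ Member (toTable N) A
  indep⇔member N A = mk⇔ (λ indA → trans (lookupᵗ∘tabulateᵗ _ A) (dec-true (indep? N A) indA))
                         (λ A∈ → does≡true⇒ (indep? N A) (trans (sym (lookupᵗ∘tabulateᵗ _ A)) A∈))

  toTable-axioms : ∀ N → MatroidAxioms (toTable N)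
  toTable-axioms N =
    to (indep-∅ N) ,
    (λ A B A⊆B → to ∘ indep-⊆ N A⊆B ∘ from) ,
    λ A B A∈ B∈ ∣A∣<∣B∣ → let x , x∈B , x∉A , indAx = indep-aug N (from A∈) (from B∈) ∣A∣<∣B∣
                          in x , x∈B , x∉A , to indAx
    where
    to   = λ {A} → Equivalence.to (indep⇔member N A)
    from = λ {A} → Equivalence.from (indep⇔member N A)

  Good : ℕ → Matroid k → Set
  Good r N = InR Y N × MatroidProperties.rk N Full ≤ r

  good? : ∀ r N → Dec (Good r N)
  good? r N = all? (λ i → MatroidProperties.flat? N (rowZero Y i)) ×-dec MatroidProperties.rk N Full ≤? r

  good-transfer : ∀ {r N N′} → (∀ A → Indep N A ⇔ Indep N′ A) → Good r N → Good r N′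
  good-transfer {r} {N} {N′} same (rows-flat , rk≤r) =
    flat-transfer {N = N} {N′} same ∘ rows-flat , subst (_≤ r) (sym (rk-transfer {N = N} {N′} same Full)) rk≤r

  goodTable? : ∀ r t → Dec (Σ[ axioms ∈ MatroidAxioms t ] Good r (fromTable t axioms))
  goodTable? r t with matroidAxioms? t
  ... | no ¬axioms = no (¬axioms ∘ proj₁)
  ... | yes axioms with good? r (fromTable t axioms)
  ...   | yes good = yes (axioms , good)
  ...   | no ¬good = no λ (axioms′ , good′) → ¬good (good-transfer (λ _ → mk⇔ (λ x → x) (λ x → x)) good′)

  minRank≤? : ∀ r → Dec (MinRank≤ Y r)
  minRank≤? r with anyTable? k (goodTable? r)
  ... | yes (t , axioms , good) = yes (fromTable t axioms , good)
  ... | no ¬good = no λ (N , good) → ¬good (toTable N , toTable-axioms N , good-transfer (indep⇔member N) good)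

  freeMatroid : Matroid k
  freeMatroid = record
    { Indep     = λ _ → ⊤
    ; indep?    = λ _ → yes tt
    ; indep-∅   = tt
    ; indep-⊆   = λ _ _ → tt
    ; indep-aug = augment
    }
    where
    augment : ∀ {A B} → ⊤ → ⊤ → ∣ A ∣ < ∣ B ∣ → ∃[ x ] (x ∈ B × x ∉ A × ⊤)
    augment {A} {B} _ _ ∣A∣<∣B∣ with ⊆-or-witness B A
    ... | inj₁ B⊆A = ⊥-elim (<⇒≱ ∣A∣<∣B∣ (p⊆q⇒∣p∣≤∣q∣ B⊆A))
    ... | inj₂ (x , x∈B , x∉A) = x , x∈B , x∉A , tt

  minRank≤k : MinRank≤ Y k
  minRank≤k =
    freeMatroid ,
    (λ _ → MatroidProperties.indep-extension⇒flat freeMatroid λ _ _ _ → tt) ,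
    ∣p∣≤n (MatroidProperties.basisOf freeMatroid Full)

  minRank≤-mono : ∀ {i j} → i ≤ j → MinRank≤ Y i → MinRank≤ Y j
  minRank≤-mono i≤j (N , rows-flat , rk≤i) = N , rows-flat , ≤-trans rk≤i i≤j

  least⇒minRank : ∀ {r} → MinRank≤ Y r → (∀ {j} → j < r → ¬ MinRank≤ Y j) → IsMinRank Y r
  least⇒minRank {r} (N , rows-flat , rk≤r) below =
    (N , rows-flat , subst (HasRank N) rk≡r (rk-isRank Full)) , minimal
    where
    open MatroidProperties N using (rk; rk-isRank)
    rk≡r : rk Full ≡ r
    rk≡r = ≤-antisym rk≤r (≮⇒≥ λ rk<r → below rk<r (N , rows-flat , ≤-refl))
    minimal : ∀ (N′ : Matroid k) r′ → InR Y N′ → HasRank N′ r′ → r ≤ r′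
    minimal N′ r′ rows-flat′ R′ =
      ≮⇒≥ λ r′<r → below r′<r (N′ , rows-flat′ , ≤-reflexive (MatroidProperties.rk≡ N′ R′))

  minRank : Σ ℕ (IsMinRank Y)
  minRank =
    let r , r-member , below = least-witness minRank≤? minRank≤-mono minRank≤k
    in r , least⇒minRank r-member below

theorem5p7 : ∀ {n h} (M : Matroid n) (X : Pattern n h) →
    IsFundamentalPattern M (transpose X) →
    ((¬ HasAdjoint M) ⇔ MrGtTri X)
theorem5p7 M X fp = mk⇔ noAdjoint⇒mr>tri mr>tri⇒noAdjoint
  where
  open FundamentalPattern M X fp
  open Equivalence hasAdjoint⇔minRank≤r

  noAdjoint⇒mr>tri : ¬ HasAdjoint M → MrGtTri X
  noAdjoint⇒mr>tri noAdjoint with m , isMin@((N , rows-flat , rankN≡m) , _) ← MinRank.minRank X =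
    m , r , isMin , tri≡rank , ≰⇒> λ m≤r →
      noAdjoint (from (N , rows-flat , ≤-trans (≤-reflexive (MatroidProperties.rk≡ N rankN≡m)) m≤r))

  mr>tri⇒noAdjoint : MrGtTri X → ¬ HasAdjoint M
  mr>tri⇒noAdjoint (m , t , (_ , mr-minimal) , (_ , tri-maximal) , t<m) adjoint =
    let N , rows-flat , rkN≤r = to adjoint
    in <⇒≱ t<m (begin
      m                                 ≤⟨ mr-minimal N _ rows-flat (MatroidProperties.rk-isRank N Full) ⟩
      MatroidProperties.rk N Full       ≤⟨ rkN≤r ⟩
      r                                 ≤⟨ tri-maximal r rank-triangle ⟩
      t                                 ∎)
    where open ≤-Reasoning
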